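{- There is a Borel reduction of $E_0$ to $\mathrel{E_{\mathbb{Z}}}$ (restricted to almost periodic functions) whose image is contained in a single $\mathrel{E_{\mathrm{fin}}}$-class. In particular, there is an $\mathrel{E_{\mathrm{fin}}}$-class containing continuum many pairwise non-$\mathrel{E_{\mathbb{Z}}}$-equivalent almost periodic functions.
   Context: $E_0$ is the equivalence relation on $2^\omega$ of eventual equality. Functions $\mathbb{Z}\to\mathbb{N}\cup\{\infty\}$ form the Polish space $(\mathbb{N}\cup\{\infty\})^{\mathbb{Z}}$ with the product of discrete topologies. A function $f\colon\mathbb{Z}\to\mathbb{N}\cup\{\infty\}$ is almost periodic if it is not periodic but for every $n\in\mathbb{N}$ the function $\min(n,f)$ is periodic. $f\mathrel{E_{\mathbb{Z}}}g$ means there is $n\in\mathbb{Z}$ with $f(m)=g(m+n)$ for all $m$; $f\mathrel{E_{\mathrm{fin}}}g$ means $\min(\ell,f)\mathrel{E_{\mathbb{Z}}}\min(\ell,g)$ for every $\ell\in\mathbb{N}$. A Borel reduction of $E$ to $F$ is a Borel map $\phi$ with $x\mathrel{E}y\iff\phi(x)\mathrel{F}\phi(y)$. -}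

module Defs where

open import Data.Nat using (ℕ; _≤_; _⊓_)
open import Data.Integer using (ℤ; +_; _+_)
open import Data.Bool using (Bool)
open import Data.Product using (Σ; _×_)
open import Data.Empty using (⊥)
open import Relation.Nullary using (¬_)
open import Relation.Binary.PropositionalEquality using (_≡_)

data ℕ∞ : Set where
  fin : ℕ → ℕ∞
  ∞   : ℕ∞

Cantor : Set
Cantor = ℕ → Bool

ZSpace : Set
ZSpace = ℤ → ℕ∞

min∞ : ℕ → ℕ∞ → ℕ∞
min∞ n (fin k) = fin (n ⊓ k)
min∞ n ∞       = fin n

trunc : ℕ → ZSpace → ZSpace
trunc n f m = min∞ n (f m)

Periodic : ZSpace → Set
Periodic f = Σ ℕ λ k → ∀ (m : ℤ) → f (m + + (Data.Nat.suc k)) ≡ f m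

AlmostPeriodic : ZSpace → Set
AlmostPeriodic f = (¬ Periodic f) × (∀ (n : ℕ) → Periodic (trunc n f))

E₀ : Cantor → Cantor → Set
E₀ x y = Σ ℕ λ N → ∀ (n : ℕ) → N ≤ n → x n ≡ y n

E-ℤ : ZSpace → ZSpace → Set
E-ℤ f g = Σ ℤ λ n → ∀ (m : ℤ) → f m ≡ g (m + n)

E-fin : ZSpace → ZSpace → Set
E-fin f g = ∀ (ℓ : ℕ) → E-ℤ (trunc ℓ f) (trunc ℓ g)

-- Borel codes on 2^ω: σ-algebra generated by the subbasic clopen sets {x | x n = b}
data BorelCode : Set where
  basic : ℕ → Bool → BorelCode
  compl : BorelCode → BorelCode
  union : (ℕ → BorelCode) → BorelCode

⟦_⟧ : BorelCode → Cantor → Set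
⟦ basic n b ⟧ x = x n ≡ b
⟦ compl c ⟧ x = ¬ ⟦ c ⟧ x
⟦ union c ⟧ x = Σ ℕ λ i → ⟦ c i ⟧ x

IsBorel : (Cantor → Set) → Set
IsBorel A = Σ BorelCode λ c → ∀ x → (A x → ⟦ c ⟧ x) × (⟦ c ⟧ x → A x)

-- φ : 2^ω → (ℕ∪{∞})^ℤ is Borel: preimages of the subbasic open sets
-- {f | f z = v} (which generate the Borel σ-algebra of the countable product) are Borel
BorelMap : (Cantor → ZSpace) → Set
BorelMap φ = ∀ (z : ℤ) (v : ℕ∞) → IsBorel (λ x → φ x z ≡ v)

BorelReduction-E₀-Eℤ : (Cantor → ZSpace) → Set
BorelReduction-E₀-Eℤ φ =
  BorelMap φ × (∀ x y → (E₀ x y → E-ℤ (φ x) (φ y)) × (E-ℤ (φ x) (φ y) → E₀ x y))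

-- Read a digit sequence d as the 2-adic integer D = Σⱼ d j 2ʲ and send it to m ↦ v₂(m + D).
-- The truncation min(n, v₂(m + D)) only depends on m + D mod 2ⁿ, so it is 2ⁿ-periodic, and two
-- such functions agree up to a shift by any integer ≡ D − D′ mod 2ⁿ: all of them lie in one
-- E_fin-class. Shifting by s turns D into D + s; conversely, if v₂(m + D) = v₂(m + s + D′) for
-- all m, reading off the carries digit by digit gives D = s + D′. Interleaving the bits of x with
-- the digits 0, 1 makes v₂(m + D) finite and the function non-periodic, and D − D′ ∈ ℤ then
-- happens exactly when the digit sequences are eventually equal. Composing with a map that
-- repeats every coordinate infinitely often turns E₀ into equality.
module Submission where

open import Defs
open import Data.Bool using (Bool; true; false; _≟_)
open import Data.Empty using (⊥-elim)
open import Data.Integer using (ℤ; +_; -[1+_]; _+_; _-_; _*_; -_; ∣_∣)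
import Data.Integer.Properties as ℤₚ
open import Data.Integer.Tactic.RingSolver using (solve-∀)
open import Data.Nat as ℕ using (ℕ; zero; suc; _⊓_; _≤_; _<_; z≤n; s≤s; s≤s⁻¹; ⌊_/2⌋; _^_; _∸_)
import Data.Nat.Properties as ℕₚ
open import Data.Product using (Σ; _×_; _,_; proj₁; proj₂)
open import Data.Sum using (_⊎_; inj₁; inj₂)
open import Data.Unit using (⊤; tt)
open import Function using (_∘_)
open import Relation.Binary.PropositionalEquality
  using (_≡_; _≢_; refl; sym; trans; cong; cong₂; subst; subst₂; module ≡-Reasoning)
open import Relation.Nullary using (¬_; Dec; yes; no)

bit : Bool → ℤ
bit false = + 0
bit true  = + 1

odd : ℤ → Bool
odd (+ 0)              = false
odd (+ 1)              = true
odd (+ suc (suc n))    = odd (+ n)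
odd -[1+ 0 ]           = true
odd -[1+ 1 ]           = false
odd -[1+ suc (suc n) ] = odd -[1+ n ]

half : ℤ → ℤ
half (+ n)    = + ⌊ n /2⌋
half -[1+ n ] = -[1+ ⌊ n /2⌋ ]

2k+[b+2h]≡b+2[k+h] : ∀ k b h → + 2 * k + (b + + 2 * h) ≡ b + + 2 * (k + h)
2k+[b+2h]≡b+2[k+h] = solve-∀

y≡bit[odd]+2*half : ∀ y → y ≡ bit (odd y) + + 2 * half y
y≡bit[odd]+2*half (+ 0)              = refl
y≡bit[odd]+2*half (+ 1)              = refl
y≡bit[odd]+2*half (+ suc (suc n))    = trans (cong (λ y → + 2 + y) (y≡bit[odd]+2*half (+ n)))
  (2k+[b+2h]≡b+2[k+h] (+ 1) (bit (odd (+ n))) (half (+ n)))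
y≡bit[odd]+2*half -[1+ 0 ]           = refl
y≡bit[odd]+2*half -[1+ 1 ]           = refl
y≡bit[odd]+2*half -[1+ suc (suc n) ] = trans (cong (λ y → -[1+ 1 ] + y) (y≡bit[odd]+2*half -[1+ n ]))
  (2k+[b+2h]≡b+2[k+h] -[1+ 0 ] (bit (odd -[1+ n ])) (half -[1+ n ]))

2*n≤1⇒n≡0 : ∀ n → 2 ℕ.* n ≤ 1 → n ≡ 0
2*n≤1⇒n≡0 zero          _        = refl
2*n≤1⇒n≡0 (suc zero)    (s≤s ())
2*n≤1⇒n≡0 (suc (suc n)) (s≤s ())

∣2*x∣≤1⇒x≡0 : ∀ x → ∣ + 2 * x ∣ ≤ 1 → x ≡ + 0
∣2*x∣≤1⇒x≡0 x le = ℤₚ.∣i∣≡0⇒i≡0 (2*n≤1⇒n≡0 ∣ x ∣ (subst (_≤ 1) (ℤₚ.abs-* (+ 2) x) le))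

∣bit-bit∣≤1 : ∀ a b → ∣ bit a - bit b ∣ ≤ 1
∣bit-bit∣≤1 false false = z≤n
∣bit-bit∣≤1 false true  = s≤s z≤n
∣bit-bit∣≤1 true  false = s≤s z≤n
∣bit-bit∣≤1 true  true  = z≤n

bit-bit≡0⇒≡ : ∀ a b → bit a - bit b ≡ + 0 → a ≡ b
bit-bit≡0⇒≡ false false _ = refl
bit-bit≡0⇒≡ true  true  _ = refl

bit+2*-injective : ∀ a b h k → bit a + + 2 * h ≡ bit b + + 2 * k → a ≡ b × h ≡ k
bit+2*-injective a b h k eq = bit-bit≡0⇒≡ a b a-b≡0 , sym (ℤₚ.i-j≡0⇒i≡j k h k-h≡0)
  where
  open ≡-Reasoning
  2[k-h]≡a-b : + 2 * (k - h) ≡ bit a - bit b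
  2[k-h]≡a-b = begin
    + 2 * (k - h)                         ≡⟨ difference (bit b) k h ⟩
    (bit b + + 2 * k) - (bit b + + 2 * h) ≡⟨ cong (_- (bit b + + 2 * h)) (sym eq) ⟩
    (bit a + + 2 * h) - (bit b + + 2 * h) ≡⟨ cancel (bit a) (bit b) h ⟩
    bit a - bit b                         ∎
    where
    difference : ∀ b k h → + 2 * (k - h) ≡ (b + + 2 * k) - (b + + 2 * h)
    difference = solve-∀
    cancel : ∀ a b h → (a + + 2 * h) - (b + + 2 * h) ≡ a - b
    cancel = solve-∀
  k-h≡0 : k - h ≡ + 0
  k-h≡0 = ∣2*x∣≤1⇒x≡0 (k - h) (subst (λ z → ∣ z ∣ ≤ 1) (sym 2[k-h]≡a-b) (∣bit-bit∣≤1 a b))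
  a-b≡0 : bit a - bit b ≡ + 0
  a-b≡0 = trans (sym 2[k-h]≡a-b) (cong (λ z → + 2 * z) k-h≡0)

odd-half-unique : ∀ {y} b h → y ≡ bit b + + 2 * h → odd y ≡ b × half y ≡ h
odd-half-unique {y} b h eq =
  bit+2*-injective (odd y) b (half y) h (trans (sym (y≡bit[odd]+2*half y)) eq)

even⇒y≡2*half : ∀ {y} → odd y ≡ false → y ≡ + 2 * half y
even⇒y≡2*half {y} ev = trans (y≡bit[odd]+2*half y)
  (trans (cong (λ b → bit b + + 2 * half y) ev) (ℤₚ.+-identityˡ (+ 2 * half y)))

odd-half-+2* : ∀ y c → odd (y + + 2 * c) ≡ odd y × half (y + + 2 * c) ≡ half y + c
odd-half-+2* y c = odd-half-unique (odd y) (half y + c) (begin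
  y + + 2 * c                                 ≡⟨ cong (_+ + 2 * c) (y≡bit[odd]+2*half y) ⟩
  bit (odd y) + + 2 * half y + + 2 * c        ≡⟨ regroup (bit (odd y)) (half y) c ⟩
  bit (odd y) + + 2 * (half y + c)            ∎)
  where
  open ≡-Reasoning
  regroup : ∀ b h c → b + + 2 * h + + 2 * c ≡ b + + 2 * (h + c)
  regroup = solve-∀

2*a≤1+c⇒a≤1⊎a<c : ∀ a c → 2 ℕ.* a ≤ suc c → a ≤ 1 ⊎ a < c
2*a≤1+c⇒a≤1⊎a<c zero          c _  = inj₁ z≤n
2*a≤1+c⇒a≤1⊎a<c (suc zero)    c _  = inj₁ ℕₚ.≤-refl
2*a≤1+c⇒a≤1⊎a<c (suc (suc a)) c le = inj₂ (ℕₚ.≤-trans (s≤s (ℕₚ.m≤n+m (suc (suc a)) a)) (s≤s⁻¹ le′))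
  where
  le′ : suc (suc (a ℕ.+ suc (suc a))) ≤ suc c
  le′ = subst (_≤ suc c) (cong (λ n → suc (suc (a ℕ.+ suc (suc n)))) (ℕₚ.+-identityʳ a)) le

halving-shrinks : ∀ s s′ → ∣ s - + 2 * s′ ∣ ≤ 1 → ∣ s′ ∣ ≤ 1 ⊎ ∣ s′ ∣ < ∣ s ∣
halving-shrinks s s′ le = 2*a≤1+c⇒a≤1⊎a<c ∣ s′ ∣ ∣ s ∣ (begin
  2 ℕ.* ∣ s′ ∣                        ≡⟨ ℤₚ.abs-* (+ 2) s′ ⟨
  ∣ + 2 * s′ ∣                        ≡⟨ cong ∣_∣ (s-[s-t]≡t s (+ 2 * s′)) ⟨
  ∣ s - (s - + 2 * s′) ∣              ≤⟨ ℤₚ.∣i-j∣≤∣i∣+∣j∣ s (s - + 2 * s′) ⟩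
  ∣ s ∣ ℕ.+ ∣ s - + 2 * s′ ∣          ≤⟨ ℕₚ.+-monoʳ-≤ ∣ s ∣ le ⟩
  ∣ s ∣ ℕ.+ 1                         ≡⟨ ℕₚ.+-comm ∣ s ∣ 1 ⟩
  suc ∣ s ∣                           ∎)
  where
  open ℕₚ.≤-Reasoning
  s-[s-t]≡t : ∀ s t → s - (s - t) ≡ t
  s-[s-t]≡t = solve-∀

even-step-shrinks : ∀ m b → odd (m + bit b) ≡ false →
                    ∣ half (m + bit b) ∣ ≤ 1 ⊎ ∣ half (m + bit b) ∣ < ∣ m ∣
even-step-shrinks m b ev = halving-shrinks m (half (m + bit b))
  (subst (λ z → ∣ z ∣ ≤ 1) (sym m-2h≡-b) (∣-bit∣≤1 b))
  where
  open ≡-Reasoning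
  m-2h≡-b : m - + 2 * half (m + bit b) ≡ - bit b
  m-2h≡-b = begin
    m - + 2 * half (m + bit b) ≡⟨ cong (λ z → m - z) (even⇒y≡2*half ev) ⟨
    m - (m + bit b)            ≡⟨ m-[m+b]≡-b m (bit b) ⟩
    - bit b                    ∎
    where
    m-[m+b]≡-b : ∀ m b → m - (m + b) ≡ - b
    m-[m+b]≡-b = solve-∀
  ∣-bit∣≤1 : ∀ b → ∣ - bit b ∣ ≤ 1
  ∣-bit∣≤1 false = z≤n
  ∣-bit∣≤1 true  = s≤s z≤n

stopIfOdd : Bool → ℕ → ℕ
stopIfOdd true  _ = 0
stopIfOdd false r = suc r

-- ν n d j m = min(n, v₂(m + D)), where D = Σᵢ d (j + i) 2ⁱ is a 2-adic integer:
-- m + D is odd iff m + d j is, and otherwise (m + D) / 2 = half (m + d j) + Σᵢ d (j + 1 + i) 2ⁱ.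
ν : ℕ → (ℕ → Bool) → ℕ → ℤ → ℕ
ν zero    d j m = 0
ν (suc n) d j m = stopIfOdd (odd (m + bit (d j))) (ν n d (suc j) (half (m + bit (d j))))

stopIfOdd-+2* : ∀ y c (r : ℤ → ℕ) →
                stopIfOdd (odd (y + + 2 * c)) (r (half (y + + 2 * c))) ≡ stopIfOdd (odd y) (r (half y + c))
stopIfOdd-+2* y c r rewrite proj₁ (odd-half-+2* y c) | proj₂ (odd-half-+2* y c) = refl

ν-even : ∀ n d j m h → m + bit (d j) ≡ + 2 * h → ν (suc n) d j m ≡ suc (ν n d (suc j) h)
ν-even n d j m h eq
  rewrite proj₁ (odd-half-unique false h (trans eq (sym (ℤₚ.+-identityˡ (+ 2 * h)))))
        | proj₂ (odd-half-unique false h (trans eq (sym (ℤₚ.+-identityˡ (+ 2 * h))))) = refl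

ν-at-0 : ∀ n d j → d j ≡ true → ν n d j (+ 0) ≡ 0
ν-at-0 zero    d j _  = refl
ν-at-0 (suc n) d j dj rewrite dj = refl

ν-periodic : ∀ n d j m → ν n d j (m + + (2 ^ n)) ≡ ν n d j m
ν-periodic zero    d j m = refl
ν-periodic (suc n) d j m = begin
  ν (suc n) d j (m + + (2 ^ suc n))                   ≡⟨ cong (λ z → stopIfOdd (odd z) (rest (half z))) shift ⟩
  stopIfOdd (odd (y + c)) (rest (half (y + c)))       ≡⟨ stopIfOdd-+2* y (+ (2 ^ n)) rest ⟩
  stopIfOdd (odd y) (rest (half y + + (2 ^ n)))       ≡⟨ cong (stopIfOdd (odd y)) (ν-periodic n d (suc j) (half y)) ⟩
  ν (suc n) d j m                                     ∎
  where
  open ≡-Reasoning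
  y = m + bit (d j)
  c = + 2 * + (2 ^ n)
  rest = ν n d (suc j)
  shift : m + + (2 ^ suc n) + bit (d j) ≡ y + c
  shift = trans (cong (λ z → m + z + bit (d j)) (ℤₚ.pos-* 2 (2 ^ n))) (swap m (bit (d j)) (+ (2 ^ n)))
    where
    swap : ∀ m b c → m + + 2 * c + b ≡ m + b + + 2 * c
    swap = solve-∀

digitDiff : ℕ → (ℕ → Bool) → (ℕ → Bool) → ℕ → ℤ
digitDiff zero    d e j = + 0
digitDiff (suc ℓ) d e j = (bit (d j) - bit (e j)) + + 2 * digitDiff ℓ d e (suc j)

ν-digitDiff : ∀ ℓ d e j m → ν ℓ d j m ≡ ν ℓ e j (m + digitDiff ℓ d e j)
ν-digitDiff zero    d e j m = refl
ν-digitDiff (suc ℓ) d e j m = sym (begin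
  ν (suc ℓ) e j (m + digitDiff (suc ℓ) d e j)     ≡⟨ cong (λ z → stopIfOdd (odd z) (rest (half z))) carry ⟩
  stopIfOdd (odd (y + c)) (rest (half (y + c)))   ≡⟨ stopIfOdd-+2* y s rest ⟩
  stopIfOdd (odd y) (rest (half y + s))           ≡⟨ cong (stopIfOdd (odd y)) (ν-digitDiff ℓ d e (suc j) (half y)) ⟨
  ν (suc ℓ) d j m                                 ∎)
  where
  open ≡-Reasoning
  y = m + bit (d j)
  s = digitDiff ℓ d e (suc j)
  c = + 2 * s
  rest = ν ℓ e (suc j)
  carry : m + digitDiff (suc ℓ) d e j + bit (e j) ≡ y + c
  carry = regroup m (bit (d j)) (bit (e j)) s
    where
    regroup : ∀ m a b s → m + ((a - b) + + 2 * s) + b ≡ m + a + + 2 * s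
    regroup = solve-∀

⊓-ν : ∀ {n N} d j m → n ≤ N → n ⊓ ν N d j m ≡ ν n d j m
⊓-ν {zero}  {N}     d j m _ = refl
⊓-ν {suc n} {suc N} d j m (s≤s n≤N) with odd (m + bit (d j))
... | true  = refl
... | false = cong suc (⊓-ν d (suc j) (half (m + bit (d j))) n≤N)

ν-stable : ∀ N n d j m → ν N d j m < N → ν n d j m ≡ n ⊓ ν N d j m
ν-stable (suc N) zero    d j m lt = refl
ν-stable (suc N) (suc n) d j m lt with odd (m + bit (d j))
... | true  = refl
... | false = cong suc (ν-stable N n d (suc j) (half (m + bit (d j))) (s≤s⁻¹ lt))

ν-cong : ∀ n d e j m → (∀ i → i < j ℕ.+ n → d i ≡ e i) → ν n d j m ≡ ν n e j m
ν-cong zero    d e j m agree = refl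
ν-cong (suc n) d e j m agree rewrite agree j (ℕₚ.m<m+n j (s≤s z≤n)) =
  cong (stopIfOdd _) (ν-cong n d e (suc j) _ (λ i lt → agree i (subst (i <_) (sym (ℕₚ.+-suc j n)) lt)))

ZeroOneRecurrent : (ℕ → Bool) → Set
ZeroOneRecurrent d = ∀ j → Σ ℕ λ t → t ≤ 2 × d (t ℕ.+ j) ≡ false × d (suc (t ℕ.+ j)) ≡ true

module _ {d : ℕ → Bool} where

  ν-≤-next01 : ∀ t j m n → ∣ m ∣ ≤ 1 → d (t ℕ.+ j) ≡ false → d (suc (t ℕ.+ j)) ≡ true → ν n d j m ≤ suc t
  ν-≤-next01 t j m zero    _     _  _  = z≤n
  ν-≤-next01 t j m (suc n) small d0 d1 with odd (m + bit (d j)) in ev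
  ... | true  = z≤n
  ... | false = s≤s (rest t d0 d1)
    where
    m′ = half (m + bit (d j))
    rest : ∀ t → d (t ℕ.+ j) ≡ false → d (suc (t ℕ.+ j)) ≡ true → ν n d (suc j) m′ ≤ t
    rest zero    d0 d1 = ℕₚ.≤-reflexive (trans (cong (ν n d (suc j)) m′≡0) (ν-at-0 n d (suc j) d1))
      where
      m≡2m′ : m ≡ + 2 * m′
      m≡2m′ = trans (sym (trans (cong (λ b → m + bit b) d0) (ℤₚ.+-identityʳ m))) (even⇒y≡2*half ev)
      m′≡0 : m′ ≡ + 0
      m′≡0 = ∣2*x∣≤1⇒x≡0 m′ (subst (λ z → ∣ z ∣ ≤ 1) m≡2m′ small)
    rest (suc t) d0 d1 = ν-≤-next01 t (suc j) m′ n small′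
      (subst (λ i → d i ≡ false) (sym (ℕₚ.+-suc t j)) d0)
      (subst (λ i → d (suc i) ≡ true) (sym (ℕₚ.+-suc t j)) d1)
      where
      small′ : ∣ m′ ∣ ≤ 1
      small′ with even-step-shrinks m (d j) ev
      ... | inj₁ ≤1 = ≤1
      ... | inj₂ <m = ℕₚ.<⇒≤ (ℕₚ.<-≤-trans <m small)

  -- Even steps shrink ∣ m ∣ until it is at most 1; from then on the next digits 0, 1 stop the
  -- count within three more steps.
  ν-<-fuel : ZeroOneRecurrent d → ∀ k j m n → ∣ m ∣ ≤ suc k → k ℕ.+ 4 ≤ n → ν n d j m < n
  ν-<-fuel rec zero    j m n       small le with rec j
  ... | t , t≤2 , d0 , d1 = ℕₚ.<-≤-trans (s≤s (ℕₚ.≤-trans (ν-≤-next01 t j m n small d0 d1) (s≤s t≤2))) le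
  ν-<-fuel rec (suc k) j m (suc n) bound (s≤s le) with odd (m + bit (d j)) in ev
  ... | true  = s≤s z≤n
  ... | false = s≤s (ν-<-fuel rec k (suc j) (half (m + bit (d j))) n bound′ le)
    where
    bound′ : ∣ half (m + bit (d j)) ∣ ≤ suc k
    bound′ with even-step-shrinks m (d j) ev
    ... | inj₁ ≤1 = ℕₚ.≤-trans ≤1 (s≤s z≤n)
    ... | inj₂ <m = s≤s⁻¹ (ℕₚ.<-≤-trans <m bound)

fuel : ℤ → ℕ
fuel m = ∣ m ∣ ℕ.+ 4

valuation : (ℕ → Bool) → ZSpace
valuation d m = fin (ν (fuel m) d 0 m)

module _ {d : ℕ → Bool} (rec : ZeroOneRecurrent d) where

  ν-fuel-< : ∀ m → ν (fuel m) d 0 m < fuel m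
  ν-fuel-< m = ν-<-fuel rec ∣ m ∣ 0 m (fuel m) (ℕₚ.n≤1+n ∣ m ∣) ℕₚ.≤-refl

  trunc-valuation : ∀ n m → trunc n (valuation d) m ≡ fin (ν n d 0 m)
  trunc-valuation n m = cong fin (sym (ν-stable (fuel m) n d 0 m (ν-fuel-< m)))

  ν-beyond-fuel : ∀ m n → fuel m ≤ n → ν n d 0 m ≡ ν (fuel m) d 0 m
  ν-beyond-fuel m n le =
    trans (ν-stable (fuel m) n d 0 m (ν-fuel-< m)) (ℕₚ.m≥n⇒m⊓n≡n (ℕₚ.≤-trans (ℕₚ.<⇒≤ (ν-fuel-< m)) le))

  valuation-truncPeriodic : ∀ n → Periodic (trunc n (valuation d))
  valuation-truncPeriodic n = 2 ^ n ∸ 1 , λ m → begin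
    trunc n (valuation d) (m + + suc (2 ^ n ∸ 1)) ≡⟨ trunc-valuation n _ ⟩
    fin (ν n d 0 (m + + suc (2 ^ n ∸ 1)))         ≡⟨ cong (λ k → fin (ν n d 0 (m + + k))) 1+[2^n∸1]≡2^n ⟩
    fin (ν n d 0 (m + + (2 ^ n)))                 ≡⟨ cong fin (ν-periodic n d 0 m) ⟩
    fin (ν n d 0 m)                               ≡⟨ trunc-valuation n m ⟨
    trunc n (valuation d) m                       ∎
    where
    open ≡-Reasoning
    1+[2^n∸1]≡2^n : suc (2 ^ n ∸ 1) ≡ 2 ^ n
    1+[2^n∸1]≡2^n = ℕₚ.m+[n∸m]≡n (ℕₚ.m^n>0 2 n)

module _ {d e : ℕ → Bool} (rd : ZeroOneRecurrent d) (re : ZeroOneRecurrent e) where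
  open ≡-Reasoning

  ν-agree⇒valuation-≡ : ∀ m m′ → (∀ n → ν n d 0 m ≡ ν n e 0 m′) → valuation d m ≡ valuation e m′
  ν-agree⇒valuation-≡ m m′ same = cong fin (begin
    ν (fuel m) d 0 m     ≡⟨ ν-beyond-fuel rd m N (ℕₚ.m≤m+n (fuel m) (fuel m′)) ⟨
    ν N d 0 m            ≡⟨ same N ⟩
    ν N e 0 m′           ≡⟨ ν-beyond-fuel re m′ N (ℕₚ.m≤n+m (fuel m′) (fuel m)) ⟩
    ν (fuel m′) e 0 m′   ∎)
    where
    N = fuel m ℕ.+ fuel m′

  valuation-E-fin : E-fin (valuation d) (valuation e)
  valuation-E-fin ℓ = digitDiff ℓ d e 0 , λ m → begin
    trunc ℓ (valuation d) m                        ≡⟨ trunc-valuation rd ℓ m ⟩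
    fin (ν ℓ d 0 m)                                ≡⟨ cong fin (ν-digitDiff ℓ d e 0 m) ⟩
    fin (ν ℓ e 0 (m + digitDiff ℓ d e 0))          ≡⟨ trunc-valuation re ℓ _ ⟨
    trunc ℓ (valuation e) (m + digitDiff ℓ d e 0)  ∎

module _ {d e : ℕ → Bool} {L : ℕ} (agree : ∀ i → L ≤ i → d i ≡ e i) where

  digitDiff-beyond : ∀ a j → L ≤ j → digitDiff a d e j ≡ + 0
  digitDiff-beyond zero    j _   = refl
  digitDiff-beyond (suc a) j L≤j
    rewrite agree j L≤j | digitDiff-beyond a (suc j) (ℕₚ.m≤n⇒m≤1+n L≤j) = b-b+2*0≡0 (bit (e j))
    where
    b-b+2*0≡0 : ∀ b → (b - b) + + 2 * + 0 ≡ + 0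
    b-b+2*0≡0 = solve-∀

  digitDiff-stable : ∀ ℓ a j → L ≤ ℓ ℕ.+ j → digitDiff (ℓ ℕ.+ a) d e j ≡ digitDiff ℓ d e j
  digitDiff-stable zero    a j le = digitDiff-beyond a j le
  digitDiff-stable (suc ℓ) a j le = cong (λ z → (bit (d j) - bit (e j)) + + 2 * z)
    (digitDiff-stable ℓ a (suc j) (subst (L ≤_) (sym (ℕₚ.+-suc ℓ j)) le))

valuation-E-ℤ : ∀ {d e} → ZeroOneRecurrent d → ZeroOneRecurrent e → E₀ d e → E-ℤ (valuation d) (valuation e)
valuation-E-ℤ {d} {e} rd re (L , agree) = s , λ m → ν-agree⇒valuation-≡ rd re m (m + s) (shifted m)
  where
  open ≡-Reasoning
  s = digitDiff L d e 0
  shifted : ∀ m n → ν n d 0 m ≡ ν n e 0 (m + s)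
  shifted m n = begin
    ν n d 0 m                                           ≡⟨ ⊓-ν d 0 m n≤L+n ⟨
    n ⊓ ν (L ℕ.+ n) d 0 m                               ≡⟨ cong (n ⊓_) (ν-digitDiff (L ℕ.+ n) d e 0 m) ⟩
    n ⊓ ν (L ℕ.+ n) e 0 (m + digitDiff (L ℕ.+ n) d e 0) ≡⟨ cong (λ z → n ⊓ ν (L ℕ.+ n) e 0 (m + z)) s-stable ⟩
    n ⊓ ν (L ℕ.+ n) e 0 (m + s)                         ≡⟨ ⊓-ν e 0 (m + s) n≤L+n ⟩
    ν n e 0 (m + s)                                     ∎
    where
    n≤L+n = ℕₚ.m≤n+m n L
    s-stable = digitDiff-stable agree L n 0 (ℕₚ.m≤m+n L 0)

ν-Shift : (ℕ → Bool) → (ℕ → Bool) → ℕ → ℤ → Set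
ν-Shift d e j s = ∀ n m → ν n d j m ≡ ν n e j (m + s)

fin-injective : ∀ {a b} → fin a ≡ fin b → a ≡ b
fin-injective refl = refl

E-ℤ-valuation⇒ν-Shift : ∀ {d e} → ZeroOneRecurrent d → ZeroOneRecurrent e →
                         ((s , _) : E-ℤ (valuation d) (valuation e)) → ν-Shift d e 0 s
E-ℤ-valuation⇒ν-Shift {d} {e} rd re (s , shift) n m = fin-injective (begin
  fin (ν n d 0 m)                 ≡⟨ trunc-valuation rd n m ⟨
  min∞ n (valuation d m)          ≡⟨ cong (min∞ n) (shift m) ⟩
  min∞ n (valuation e (m + s))    ≡⟨ trunc-valuation re n (m + s) ⟩
  fin (ν n e 0 (m + s))           ∎)
  where open ≡-Reasoning

ν-1≡1⇒even : ∀ d j m → ν 1 d j m ≡ 1 → odd (m + bit (d j)) ≡ false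
ν-1≡1⇒even d j m eq with odd (m + bit (d j))
... | false = refl

module _ {d e : ℕ → Bool} {j : ℕ} {s : ℤ} (rel : ν-Shift d e j s) where

  ν-Shift-carry-even : odd (s + bit (e j) - bit (d j)) ≡ false
  ν-Shift-carry-even = subst (λ z → odd z ≡ false) (regroup (bit (d j)) s (bit (e j)))
    (ν-1≡1⇒even e j (- bit (d j) + s) (trans (sym (rel 1 (- bit (d j)))) ν-d≡1))
    where
    ν-d≡1 : ν 1 d j (- bit (d j)) ≡ 1
    ν-d≡1 = ν-even 0 d j (- bit (d j)) (+ 0) (ℤₚ.+-inverseˡ (bit (d j)))
    regroup : ∀ a s b → - a + s + b ≡ s + b - a
    regroup = solve-∀

  ν-Shift-next : ν-Shift d e (suc j) (half (s + bit (e j) - bit (d j)))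
  ν-Shift-next n m = ℕₚ.suc-injective (begin
    suc (ν n d (suc j) m)             ≡⟨ ν-even n d j y m (y+a≡2m (bit (d j)) m) ⟨
    ν (suc n) d j y                   ≡⟨ rel (suc n) y ⟩
    ν (suc n) e j (y + s)             ≡⟨ ν-even n e j (y + s) (m + half c) y+s+b≡2[m+c/2] ⟩
    suc (ν n e (suc j) (m + half c))  ∎)
    where
    open ≡-Reasoning
    c = s + bit (e j) - bit (d j)
    y = + 2 * m - bit (d j)
    y+a≡2m : ∀ a m → + 2 * m - a + a ≡ + 2 * m
    y+a≡2m = solve-∀
    y+s+b≡2[m+c/2] : y + s + bit (e j) ≡ + 2 * (m + half c)
    y+s+b≡2[m+c/2] = begin
      y + s + bit (e j)        ≡⟨ regroup m (bit (d j)) s (bit (e j)) ⟩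
      + 2 * m + c              ≡⟨ cong (λ z → + 2 * m + z) (even⇒y≡2*half ν-Shift-carry-even) ⟩
      + 2 * m + + 2 * half c   ≡⟨ ℤₚ.*-distribˡ-+ (+ 2) m (half c) ⟨
      + 2 * (m + half c)       ∎
      where
      regroup : ∀ m a s b → + 2 * m - a + s + b ≡ + 2 * m + (s + b - a)
      regroup = solve-∀

-- When ν-Shift d e 0 s holds, carries d e s j is the s′ with Σᵢ d (j + i) 2ⁱ = s′ + Σᵢ e (j + i) 2ⁱ.
carries : (ℕ → Bool) → (ℕ → Bool) → ℤ → ℕ → ℤ
carries d e s zero    = s
carries d e s (suc j) = half (carries d e s j + bit (e j) - bit (d j))

module _ {d e : ℕ → Bool} {s : ℤ} (rel : ν-Shift d e 0 s) where

  carries-ν-Shift : ∀ j → ν-Shift d e j (carries d e s j)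
  carries-ν-Shift zero    = rel
  carries-ν-Shift (suc j) = ν-Shift-next (carries-ν-Shift j)

  carries-digit : ∀ j → carries d e s j - + 2 * carries d e s (suc j) ≡ bit (d j) - bit (e j)
  carries-digit j = begin
    c - + 2 * half (c + b - a) ≡⟨ cong (λ z → c - z) (even⇒y≡2*half (ν-Shift-carry-even (carries-ν-Shift j))) ⟨
    c - (c + b - a)            ≡⟨ cancel c a b ⟩
    a - b                      ∎
    where
    open ≡-Reasoning
    c = carries d e s j
    a = bit (d j)
    b = bit (e j)
    cancel : ∀ c a b → c - (c + b - a) ≡ a - b
    cancel = solve-∀

  carries-near : ∀ j → ∣ carries d e s j - + 2 * carries d e s (suc j) ∣ ≤ 1
  carries-near j = subst (λ z → ∣ z ∣ ≤ 1) (sym (carries-digit j)) (∣bit-bit∣≤1 (d j) (e j))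

module _ (s : ℕ → ℤ) (near : ∀ j → ∣ s j - + 2 * s (suc j) ∣ ≤ 1) where

  eventually-small : ∀ k j → ∣ s j ∣ ≤ suc k → Σ ℕ λ j′ → ∣ s j′ ∣ ≤ 1
  eventually-small zero    j small = j , small
  eventually-small (suc k) j bound with halving-shrinks (s j) (s (suc j)) (near j)
  ... | inj₁ ≤1 = suc j , ≤1
  ... | inj₂ <s = eventually-small k (suc j) (s≤s⁻¹ (ℕₚ.<-≤-trans <s bound))

  small-forever : ∀ t j → ∣ s j ∣ ≤ 1 → ∣ s (t ℕ.+ j) ∣ ≤ 1
  small-forever zero    j small = small
  small-forever (suc t) j small with halving-shrinks (s (t ℕ.+ j)) (s (suc (t ℕ.+ j))) (near (t ℕ.+ j))
  ... | inj₁ ≤1 = ≤1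
  ... | inj₂ <s = ℕₚ.<⇒≤ (ℕₚ.<-≤-trans <s (small-forever t j small))

  zero-next : ∀ j → s j ≡ + 0 → s (suc j) ≡ + 0
  zero-next j z = ∣2*x∣≤1⇒x≡0 (s (suc j)) (subst (_≤ 1) ∣s-2s′∣≡∣2s′∣ (near j))
    where
    ∣s-2s′∣≡∣2s′∣ : ∣ s j - + 2 * s (suc j) ∣ ≡ ∣ + 2 * s (suc j) ∣
    ∣s-2s′∣≡∣2s′∣ = begin
      ∣ s j - + 2 * s (suc j) ∣  ≡⟨ cong (λ z → ∣ z - + 2 * s (suc j) ∣) z ⟩
      ∣ + 0 - + 2 * s (suc j) ∣  ≡⟨ cong ∣_∣ (ℤₚ.+-identityˡ (- (+ 2 * s (suc j)))) ⟩
      ∣ - (+ 2 * s (suc j)) ∣    ≡⟨ ℤₚ.∣-i∣≡∣i∣ (+ 2 * s (suc j)) ⟩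
      ∣ + 2 * s (suc j) ∣        ∎
      where open ≡-Reasoning

  zero-forever : ∀ {J} → s J ≡ + 0 → ∀ j → J ≤ j → s j ≡ + 0
  zero-forever z zero    z≤n = z
  zero-forever z (suc j) J≤1+j with ℕₚ.m≤n⇒m<n∨m≡n J≤1+j
  ... | inj₁ J<1+j = zero-next j (zero-forever z j (s≤s⁻¹ J<1+j))
  ... | inj₂ refl  = z

  eventually-zero : (∀ j → Σ ℕ λ t → s (t ℕ.+ j) ≡ + 2 * s (suc (t ℕ.+ j))) →
                    Σ ℕ λ J → ∀ j → J ≤ j → s j ≡ + 0
  eventually-zero doubles with eventually-small ∣ s 0 ∣ 0 (ℕₚ.n≤1+n ∣ s 0 ∣)
  ... | j , small with doubles j
  ... | t , s≡2s′ = suc (t ℕ.+ j) ,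
    zero-forever (∣2*x∣≤1⇒x≡0 _ (subst (λ z → ∣ z ∣ ≤ 1) s≡2s′ (small-forever t j small)))

ν-Shift⇒E₀ : ∀ {d e s} → ν-Shift d e 0 s → (∀ j → Σ ℕ λ t → d (t ℕ.+ j) ≡ e (t ℕ.+ j)) → E₀ d e
ν-Shift⇒E₀ {d} {e} {s} rel agree = J , λ i J≤i → bit-bit≡0⇒≡ (d i) (e i) (begin
  bit (d i) - bit (e i)    ≡⟨ carries-digit rel i ⟨
  c i - + 2 * c (suc i)    ≡⟨ cong₂ (λ a b → a - + 2 * b) (vanish i J≤i) (vanish (suc i) (ℕₚ.m≤n⇒m≤1+n J≤i)) ⟩
  + 0 - + 2 * + 0          ≡⟨⟩
  + 0                      ∎)
  where
  open ≡-Reasoning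
  c = carries d e s
  doubles : ∀ j → Σ ℕ λ t → c (t ℕ.+ j) ≡ + 2 * c (suc (t ℕ.+ j))
  doubles j with agree j
  ... | t , same = t , ℤₚ.i-j≡0⇒i≡j _ _ (trans (carries-digit rel (t ℕ.+ j)) (ℤₚ.i≡j⇒i-j≡0 (cong bit same)))
  J = proj₁ (eventually-zero c (carries-near rel) doubles)
  vanish = proj₂ (eventually-zero c (carries-near rel) doubles)

ν-Shift-self⇒≡0 : ∀ {d s} → ν-Shift d d 0 s → s ≡ + 0
ν-Shift-self⇒≡0 {d} {s} rel = vanishes-before J (vanish J ℕₚ.≤-refl)
  where
  c = carries d d s
  doubles : ∀ j → c j ≡ + 2 * c (suc j)
  doubles j = ℤₚ.i-j≡0⇒i≡j _ _ (trans (carries-digit rel j) (ℤₚ.+-inverseʳ (bit (d j))))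
  J = proj₁ (eventually-zero c (carries-near rel) (λ j → 0 , doubles j))
  vanish = proj₂ (eventually-zero c (carries-near rel) (λ j → 0 , doubles j))
  vanishes-before : ∀ j → c j ≡ + 0 → c 0 ≡ + 0
  vanishes-before zero    z = z
  vanishes-before (suc j) z = vanishes-before j (trans (doubles j) (cong (λ x → + 2 * x) z))

valuation-aperiodic : ∀ {d} → ZeroOneRecurrent d → ¬ Periodic (valuation d)
valuation-aperiodic {d} rec (k , periodic) = +[1+k]≢0 (ν-Shift-self⇒≡0 {d} {+ suc k} rel)
  where
  rel : ν-Shift d d 0 (+ suc k)
  rel = E-ℤ-valuation⇒ν-Shift rec rec (+ suc k , λ m → sym (periodic m))
  +[1+k]≢0 : + suc k ≢ + 0
  +[1+k]≢0 ()

pad01 : Cantor → Cantor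
pad01 x 0                   = x 0
pad01 x 1                   = false
pad01 x 2                   = true
pad01 x (suc (suc (suc p))) = pad01 (λ i → x (suc i)) p

offset01 : ℕ → ℕ
offset01 0                   = 1
offset01 1                   = 0
offset01 2                   = 2
offset01 (suc (suc (suc j))) = offset01 j

offset01≤2 : ∀ j → offset01 j ≤ 2
offset01≤2 0                   = s≤s z≤n
offset01≤2 1                   = z≤n
offset01≤2 2                   = ℕₚ.≤-refl
offset01≤2 (suc (suc (suc j))) = offset01≤2 j

pad01-+3 : ∀ x t j → pad01 x (t ℕ.+ suc (suc (suc j))) ≡ pad01 (λ i → x (suc i)) (t ℕ.+ j)
pad01-+3 x t j =
  cong (pad01 x) (trans (ℕₚ.+-suc t _) (cong suc (trans (ℕₚ.+-suc t _) (cong suc (ℕₚ.+-suc t j)))))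

pad01-offset : ∀ x j → pad01 x (offset01 j ℕ.+ j) ≡ false × pad01 x (suc (offset01 j ℕ.+ j)) ≡ true
pad01-offset x 0                   = refl , refl
pad01-offset x 1                   = refl , refl
pad01-offset x 2                   = refl , refl
pad01-offset x (suc (suc (suc j))) =
  trans (pad01-+3 x (offset01 j) j) (proj₁ (pad01-offset _ j)) ,
  trans (pad01-+3 x (suc (offset01 j)) j) (proj₂ (pad01-offset _ j))

pad01-recurrent : ∀ x → ZeroOneRecurrent (pad01 x)
pad01-recurrent x j = offset01 j , offset01≤2 j , pad01-offset x j

pad01-agree-often : ∀ x y j → Σ ℕ λ t → pad01 x (t ℕ.+ j) ≡ pad01 y (t ℕ.+ j)
pad01-agree-often x y j = offset01 j , trans (proj₁ (pad01-offset x j)) (sym (proj₁ (pad01-offset y j)))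

pad01-*3 : ∀ x i → pad01 x (i ℕ.* 3) ≡ x i
pad01-*3 x zero    = refl
pad01-*3 x (suc i) = pad01-*3 (λ k → x (suc k)) i

pad01-cong : ∀ p x y → (∀ i → i ≤ p → x i ≡ y i) → pad01 x p ≡ pad01 y p
pad01-cong 0                   x y agree = agree 0 z≤n
pad01-cong 1                   x y agree = refl
pad01-cong 2                   x y agree = refl
pad01-cong (suc (suc (suc p))) x y agree =
  pad01-cong p _ _ (λ i i≤p → agree (suc i) (s≤s (ℕₚ.m≤n⇒m≤1+n (ℕₚ.m≤n⇒m≤1+n i≤p))))

pad01-E₀ : ∀ {x y} → E₀ x y → E₀ (pad01 x) (pad01 y)
pad01-E₀ {x} {y} (N , agree) = N ℕ.* 3 , tail N x y agree
  where
  tail : ∀ N x y → (∀ i → N ≤ i → x i ≡ y i) → ∀ p → N ℕ.* 3 ≤ p → pad01 x p ≡ pad01 y p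
  tail zero    x y agree p _ = pad01-cong p x y (λ i _ → agree i z≤n)
  tail (suc N) x y agree (suc (suc (suc p))) (s≤s (s≤s (s≤s le))) =
    tail N _ _ (λ i N≤i → agree (suc i) (s≤s N≤i)) p le

E₀-pad01 : ∀ {x y} → E₀ (pad01 x) (pad01 y) → E₀ x y
E₀-pad01 {x} {y} (N , agree) = N , λ i N≤i →
  trans (sym (pad01-*3 x i)) (trans (agree (i ℕ.* 3) (ℕₚ.≤-trans N≤i (ℕₚ.m≤m*n i 3))) (pad01-*3 y i))

module _ {A B : Cantor → Set} where

  IsBorel-⇔ : IsBorel A → (∀ x → (A x → B x) × (B x → A x)) → IsBorel B
  IsBorel-⇔ (c , c⇔A) A⇔B = c , λ x →
    (λ bx → proj₁ (c⇔A x) (proj₂ (A⇔B x) bx)) , (λ cx → proj₁ (A⇔B x) (proj₂ (c⇔A x) cx))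

  IsBorel-⊎ : IsBorel A → IsBorel B → IsBorel (λ x → A x ⊎ B x)
  IsBorel-⊎ (a , a⇔A) (b , b⇔B) = union two , λ x → to x , from x
    where
    two : ℕ → BorelCode
    two zero    = a
    two (suc _) = b
    to : ∀ x → A x ⊎ B x → ⟦ union two ⟧ x
    to x (inj₁ ax) = 0 , proj₁ (a⇔A x) ax
    to x (inj₂ bx) = 1 , proj₁ (b⇔B x) bx
    from : ∀ x → ⟦ union two ⟧ x → A x ⊎ B x
    from x (zero  , ax) = inj₁ (proj₂ (a⇔A x) ax)
    from x (suc _ , bx) = inj₂ (proj₂ (b⇔B x) bx)

IsBorel-¬ : ∀ {A} → IsBorel A → IsBorel (λ x → ¬ A x)
IsBorel-¬ (c , c⇔A) = compl c , λ x →
  (λ ¬ax cx → ¬ax (proj₂ (c⇔A x) cx)) , (λ ¬cx ax → ¬cx (proj₁ (c⇔A x) ax))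

IsBorel-× : ∀ {A B} → (∀ x → Dec (A x)) → (∀ x → Dec (B x)) →
            IsBorel A → IsBorel B → IsBorel (λ x → A x × B x)
IsBorel-× {A} {B} A? B? borelA borelB =
  IsBorel-⇔ (IsBorel-¬ (IsBorel-⊎ (IsBorel-¬ borelA) (IsBorel-¬ borelB))) (λ x → to x , from x)
  where
  to : ∀ x → ¬ (¬ A x ⊎ ¬ B x) → A x × B x
  to x neither with A? x | B? x
  ... | yes ax | yes bx = ax , bx
  ... | no ¬ax | _      = ⊥-elim (neither (inj₁ ¬ax))
  ... | yes _  | no ¬bx = ⊥-elim (neither (inj₂ ¬bx))
  from : ∀ x → A x × B x → ¬ (¬ A x ⊎ ¬ B x)
  from x (ax , bx) (inj₁ ¬ax) = ¬ax ax
  from x (ax , bx) (inj₂ ¬bx) = ¬bx bx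

IsBorel-coordinate : ∀ n b → IsBorel (λ x → x n ≡ b)
IsBorel-coordinate n b = basic n b , λ x → (λ eq → eq) , (λ eq → eq)

IsBorel-⊤ : IsBorel (λ _ → ⊤)
IsBorel-⊤ = IsBorel-⇔ (IsBorel-⊎ (IsBorel-coordinate 0 true) (IsBorel-coordinate 0 false))
  (λ x → (λ _ → tt) , (λ _ → bool-cases (x 0)))
  where
  bool-cases : ∀ b → b ≡ true ⊎ b ≡ false
  bool-cases true  = inj₁ refl
  bool-cases false = inj₂ refl

IsBorel-const : ∀ {Q : Set} → Dec Q → IsBorel (λ _ → Q)
IsBorel-const (yes q) = IsBorel-⇔ IsBorel-⊤ (λ _ → (λ _ → q) , (λ _ → tt))
IsBorel-const (no ¬q) =
  IsBorel-⇔ (IsBorel-¬ IsBorel-⊤) (λ _ → (λ ¬⊤ → ⊥-elim (¬⊤ tt)) , (λ q → ⊥-elim (¬q q)))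

_[_≔_] : Cantor → ℕ → Bool → Cantor
(x [ N ≔ b ]) i with i ℕ.≟ N
... | yes _ = b
... | no  _ = x i

[≔]-self : ∀ {x N b} → x N ≡ b → ∀ i → x i ≡ (x [ N ≔ b ]) i
[≔]-self {N = N} xN≡b i with i ℕ.≟ N
... | yes refl = xN≡b
... | no  _    = refl

IsBorel-finitary : ∀ N (P : Cantor → Set) → (∀ x → Dec (P x)) →
                   (∀ x y → (∀ i → i < N → x i ≡ y i) → P x → P y) → IsBorel P
IsBorel-finitary zero P P? local =
  IsBorel-⇔ (IsBorel-const (P? (λ _ → false))) (λ x → local _ x (λ _ ()) , local x _ (λ _ ()))
IsBorel-finitary (suc N) P P? local = IsBorel-⇔ (IsBorel-⊎ (branch true) (branch false)) (λ x → from x , to x)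
  where
  P[≔_] : Bool → Cantor → Set
  P[≔ b ] x = P (x [ N ≔ b ])
  branch : ∀ b → IsBorel (λ x → x N ≡ b × P[≔ b ] x)
  branch b = IsBorel-× (λ x → x N ≟ b) (λ x → P? _) (IsBorel-coordinate N b)
                       (IsBorel-finitary N P[≔ b ] (λ x → P? _) local′)
    where
    local′ : ∀ x y → (∀ i → i < N → x i ≡ y i) → P[≔ b ] x → P[≔ b ] y
    local′ x y agree = local _ _ agree′
      where
      agree′ : ∀ i → i < suc N → (x [ N ≔ b ]) i ≡ (y [ N ≔ b ]) i
      agree′ i i<1+N with i ℕ.≟ N | ℕₚ.m<1+n⇒m<n∨m≡n i<1+N
      ... | yes _   | _        = refl
      ... | no  _   | inj₁ i<N = agree i i<N
      ... | no  i≢N | inj₂ i≡N = ⊥-elim (i≢N i≡N)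
  from : ∀ x → (x N ≡ true × P[≔ true ] x) ⊎ (x N ≡ false × P[≔ false ] x) → P x
  from x (inj₁ (xN≡b , p)) = local _ x (λ i _ → sym ([≔]-self xN≡b i)) p
  from x (inj₂ (xN≡b , p)) = local _ x (λ i _ → sym ([≔]-self xN≡b i)) p
  to : ∀ x → P x → (x N ≡ true × P[≔ true ] x) ⊎ (x N ≡ false × P[≔ false ] x)
  to x px with x N in xN≡b
  ... | true  = inj₁ (refl , local x _ (λ i _ → [≔]-self xN≡b i) px)
  ... | false = inj₂ (refl , local x _ (λ i _ → [≔]-self xN≡b i) px)

_≟∞_ : (a b : ℕ∞) → Dec (a ≡ b)
fin a ≟∞ fin b with a ℕ.≟ b
... | yes refl = yes refl
... | no  a≢b  = no (λ eq → a≢b (fin-injective eq))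
fin _ ≟∞ ∞     = no (λ ())
∞     ≟∞ fin _ = no (λ ())
∞     ≟∞ ∞     = yes refl

φ : Cantor → ZSpace
φ x = valuation (pad01 x)

φ-local : ∀ z x y → (∀ i → i < fuel z → x i ≡ y i) → φ x z ≡ φ y z
φ-local z x y agree = cong fin (ν-cong (fuel z) (pad01 x) (pad01 y) 0 z
  (λ p p<fuel → pad01-cong p x y (λ i i≤p → agree i (ℕₚ.≤-<-trans i≤p p<fuel))))

φ-Borel : BorelMap φ
φ-Borel z v = IsBorel-finitary (fuel z) (λ x → φ x z ≡ v) (λ x → φ x z ≟∞ v)
  (λ x y agree φxz≡v → trans (sym (φ-local z x y agree)) φxz≡v)

φ-E₀ : ∀ x y → E₀ x y → E-ℤ (φ x) (φ y)
φ-E₀ x y x~y = valuation-E-ℤ (pad01-recurrent x) (pad01-recurrent y) (pad01-E₀ x~y)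

φ-E-ℤ : ∀ x y → E-ℤ (φ x) (φ y) → E₀ x y
φ-E-ℤ x y φx~φy = E₀-pad01 (ν-Shift⇒E₀
  (E-ℤ-valuation⇒ν-Shift (pad01-recurrent x) (pad01-recurrent y) φx~φy) (pad01-agree-often x y))

φ-almostPeriodic : ∀ x → AlmostPeriodic (φ x)
φ-almostPeriodic x = valuation-aperiodic (pad01-recurrent x) , valuation-truncPeriodic (pad01-recurrent x)

φ-E-fin : ∀ x y → E-fin (φ x) (φ y)
φ-E-fin x y = valuation-E-fin (pad01-recurrent x) (pad01-recurrent y)

diagonal-step : ℕ × ℕ → ℕ × ℕ
diagonal-step (i , suc r) = suc i , r
diagonal-step (i , zero)  = 0 , suc i

diagonal : ℕ → ℕ × ℕ
diagonal zero    = 0 , 0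
diagonal (suc j) = diagonal-step (diagonal j)

diagonal-walk : ∀ t j i r → diagonal j ≡ (i , t ℕ.+ r) → diagonal (t ℕ.+ j) ≡ (t ℕ.+ i , r)
diagonal-walk zero    j i r eq = eq
diagonal-walk (suc t) j i r eq = subst₂ (λ j′ i′ → diagonal j′ ≡ (i′ , r)) (ℕₚ.+-suc t j) (ℕₚ.+-suc t i)
  (diagonal-walk t (suc j) (suc i) r (cong diagonal-step eq))

diagonal-column0 : ∀ K → Σ ℕ λ j → K ≤ j × diagonal j ≡ (0 , K)
diagonal-column0 zero    = 0 , z≤n , refl
diagonal-column0 (suc K) with diagonal-column0 K
... | j , K≤j , eq = suc (K ℕ.+ j) , s≤s (ℕₚ.m≤m+n K j) , cong diagonal-step end-of-row
  where
  end-of-row : diagonal (K ℕ.+ j) ≡ (K , 0)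
  end-of-row = subst (λ a → diagonal (K ℕ.+ j) ≡ (a , 0)) (ℕₚ.+-identityʳ K)
    (diagonal-walk K j 0 0 (trans eq (cong (0 ,_) (sym (ℕₚ.+-identityʳ K)))))

diagonal-hits : ∀ n N → Σ ℕ λ j → N ≤ j × proj₁ (diagonal j) ≡ n
diagonal-hits n N with diagonal-column0 (n ℕ.+ N)
... | j , n+N≤j , eq = n ℕ.+ j , ℕₚ.≤-trans (ℕₚ.m≤n+m N n) (ℕₚ.≤-trans n+N≤j (ℕₚ.m≤n+m j n)) ,
  trans (cong proj₁ (diagonal-walk n j 0 N eq)) (ℕₚ.+-identityʳ n)

spread : Cantor → Cantor
spread x j = x (proj₁ (diagonal j))

E₀-spread⇒≡ : ∀ x y → E₀ (spread x) (spread y) → ∀ n → x n ≡ y n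
E₀-spread⇒≡ x y (N , agree) n with diagonal-hits n N
... | j , N≤j , refl = agree j N≤j

theorem6p6 :
    (Σ (Cantor → ZSpace) λ φ →
        BorelReduction-E₀-Eℤ φ
      × (∀ x → AlmostPeriodic (φ x))
      × (∀ x y → E-fin (φ x) (φ y)))
    × (Σ (Cantor → ZSpace) λ g →
        (∀ x → AlmostPeriodic (g x))
      × (∀ x y → E-fin (g x) (g y))
      × (∀ x y → E-ℤ (g x) (g y) → ∀ (n : ℕ) → x n ≡ y n))
theorem6p6 =
  (φ , (φ-Borel , λ x y → φ-E₀ x y , φ-E-ℤ x y) , φ-almostPeriodic , φ-E-fin) ,
  (φ ∘ spread , φ-almostPeriodic ∘ spread , (λ x y → φ-E-fin (spread x) (spread y)) ,
   λ x y φx~φy → E₀-spread⇒≡ x y (φ-E-ℤ (spread x) (spread y) φx~φy))
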